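{- Let $\mathcal F$ be a $k$-dense union-closed family over the universe $[n]$. If there exist subsets $A_1\subsetneq A_2\subsetneq\dots\subsetneq A_r\subsetneq B_r$ of $[n]$ with $A_1,\dots,A_r\in\mathcal F$ and $B_r\notin\mathcal F$, then $r<k$.
   Context: A family $\mathcal F$ of subsets of $[n]$ is union-closed over the universe $[n]$ if $[n]\in\mathcal F$ and $A\cup B\in\mathcal F$ for all $A,B\in\mathcal F$. Convention: the empty set is never a member of any family considered; $2^{[n]}$ denotes the family of all nonempty subsets of $[n]$. The closure of a union-closed $\mathcal F$ is $\overline{\mathcal F}=\{A\in 2^{[n]}:\ \mathcal F\cup\{A\}\text{ is union-closed}\}$; iterated closures are $\overline{\mathcal F}^{(0)}=\mathcal F$, $\overline{\mathcal F}^{(i)}=\overline{\overline{\mathcal F}^{(i-1)}}$. $\mathcal F$ is $k$-dense if $k$ is the smallest nonnegative integer with $\overline{\mathcal F}^{(k)}=2^{[n]}$. -}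

module Defs where

open import Data.Nat using (ℕ; zero; suc)
open import Data.Fin.Subset using (Subset; ⊤; _∪_; Nonempty)
open import Data.Product using (_×_)
open import Data.Sum using (_⊎_)
open import Relation.Nullary using (¬_)
open import Relation.Binary.PropositionalEquality using (_≡_)

Family : ℕ → Set₁
Family n = Subset n → Set

-- Convention: the empty set is never a member of a family.
NoEmpty : ∀ {n} → Family n → Set
NoEmpty F = ∀ A → F A → Nonempty A

UnionClosed : ∀ {n} → Family n → Set
UnionClosed F = F ⊤ × (∀ A B → F A → F B → F (A ∪ B))

insert : ∀ {n} → Family n → Subset n → Family n
insert F A X = F X ⊎ X ≡ A

closure : ∀ {n} → Family n → Family n
closure F A = Nonempty A × UnionClosed (insert F A)

closure^ : ∀ {n} → ℕ → Family n → Family n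
closure^ zero    F = F
closure^ (suc i) F = closure (closure^ i F)

-- G equals 2^[n], the family of all nonempty subsets of [n].
IsPowerFamily : ∀ {n} → Family n → Set
IsPowerFamily G = ∀ A → (G A → Nonempty A) × (Nonempty A → G A)

KDense : ∀ {n} → ℕ → Family n → Set
KDense k F = IsPowerFamily (closure^ k F)
           × (∀ j → Data.Nat._<_ j k → ¬ IsPowerFamily (closure^ j F))

module Submission where

-- Call a union-closed family without the empty set "proper".
-- The closure of a proper family G over a nonempty universe is again proper
-- and contains G.  The key step is an exchange: if A ⊂ A' ⊂ B with A' ∈ G and
-- B ∉ G, then B' = (B ∖ A') ∪ A is not in the closure of G, because
-- B' ∪ A' = B ∉ G while B' ∪ A' ≠ B' (an element of A' ∖ A lies outside B').
-- Moreover A ⊂ B' and all members of G stay in the closure, so a chain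
-- A₀ ⊂ A₁ ⊂ ⋯ ⊂ Aⱼ ⊂ B (with A₁,…,Aⱼ ∈ G, B ∉ G) becomes, after one closure,
-- a chain A₀ ⊂ ⋯ ⊂ Aⱼ₋₁ ⊂ B' of the same kind.  By induction on j, each of the
-- iterated closures of orders 0,…,j misses some nonempty set.
-- For the theorem we prepend A₀ = ∅ to the given chain A₁ ⊂ ⋯ ⊂ Aᵣ: then the
-- closures of orders 0,…,r all differ from 2^[n], so k-density forces r < k.

open import Defs
open import Data.Nat using (ℕ; suc; _≤_; _<_)
open import Data.Fin.Subset using (Subset; _⊂_)
open import Relation.Nullary using (¬_)

open import Data.Nat using (zero; z≤n; s≤s)
open import Data.Nat.Properties using (≰⇒>; ≤-trans; ≤-refl; n≤1+n)
open import Data.Fin using (Fin)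
open import Data.Fin.Subset using (_∪_; _∩_; ∁; ⊤; ⊥; _∈_; _∉_; _⊆_; Nonempty)
open import Data.Fin.Subset.Properties
  using (_∈?_; x∈p∪q⁻; x∈p∪q⁺; x∈p∩q⁺; x∈p∩q⁻; x∈∁p⇒x∉p; x∉p⇒x∈∁p;
         ⊆-antisym; ∪-assoc; ∪-comm; ∪-idem; ∪-zeroˡ; ∪-zeroʳ; ∈⊤; ∉⊥)
open import Data.Product using (Σ; _×_; _,_; proj₁; proj₂)
open import Data.Sum using (inj₁; inj₂)
open import Data.Empty using (⊥-elim)
open import Relation.Nullary using (yes; no)
open import Relation.Binary.PropositionalEquality
  using (_≡_; refl; sym; trans; subst; cong)

module _ {n : ℕ} where

  Proper : Family n → Set
  Proper G = UnionClosed G × NoEmpty G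

  Misses : Family n → Set
  Misses G = Σ (Subset n) λ X → Nonempty X × ¬ G X

  misses⇒notPower : ∀ {G} → Misses G → ¬ IsPowerFamily G
  misses⇒notPower (X , neX , X∉G) power = X∉G (proj₂ (power X) neX)

  member⇒closure : ∀ {G} → Proper G → ∀ X → G X → closure G X
  member⇒closure {G} ((G⊤ , G∪) , noEmpty) X X∈G = noEmpty X X∈G , (inj₁ G⊤ , closed)
    where
    closed : ∀ C D → insert G X C → insert G X D → insert G X (C ∪ D)
    closed C  D  (inj₁ c)    (inj₁ d)    = inj₁ (G∪ C D c d)
    closed C  .X (inj₁ c)    (inj₂ refl) = inj₁ (G∪ C X c X∈G)
    closed .X D  (inj₂ refl) (inj₁ d)    = inj₁ (G∪ X D X∈G d)
    closed .X .X (inj₂ refl) (inj₂ refl) = inj₁ (G∪ X X X∈G X∈G)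

  absorbed : ∀ (X C D : Subset n) → (X ∪ C) ∪ D ≡ D → X ∪ (C ∪ D) ≡ C ∪ D
  absorbed X C D e = ⊆-antisym into (λ h → x∈p∪q⁺ (inj₂ h))
    where
    into : X ∪ (C ∪ D) ⊆ C ∪ D
    into {x} h = x∈p∪q⁺ (inj₂ (subst (x ∈_) e (subst (x ∈_) (sym (∪-assoc X C D)) h)))

  -- If C, D lie in the closure of G, then adding a member X of G to C ∪ D
  -- lands in G ∪ {C ∪ D}: first X ∪ C ∈ G ∪ {C}, then (X ∪ C) ∪ D ∈ G ∪ {D}.
  closure-absorbs : ∀ {G} C D → closure G C → closure G D
                  → ∀ X → G X → insert G (C ∪ D) (X ∪ (C ∪ D))
  closure-absorbs {G} C D (_ , (_ , closedC)) (_ , (_ , closedD)) X X∈G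
    with closedC X C (inj₁ X∈G) (inj₂ refl)
  ... | inj₂ XC≡C = inj₂ (trans (sym (∪-assoc X C D)) (cong (_∪ D) XC≡C))
  ... | inj₁ XC∈G with closedD (X ∪ C) D (inj₁ XC∈G) (inj₂ refl)
  ...   | inj₁ XCD∈G = inj₁ (subst G (∪-assoc X C D) XCD∈G)
  ...   | inj₂ XCD≡D = inj₂ (absorbed X C D XCD≡D)

  closure-proper : ∀ {G} → Fin n → Proper G → Proper (closure G)
  closure-proper {G} w ((G⊤ , G∪) , _) = (⊤∈closure , ∪-closure) , λ _ → proj₁
    where
    ⊤∈closure : closure G ⊤
    ⊤∈closure = (w , ∈⊤) , (inj₁ G⊤ , closed)
      where
      closed : ∀ C D → insert G ⊤ C → insert G ⊤ D → insert G ⊤ (C ∪ D)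
      closed C  D  (inj₁ c)    (inj₁ d) = inj₁ (G∪ C D c d)
      closed C  .⊤ _           (inj₂ refl) = inj₂ (∪-zeroʳ C)
      closed .⊤ D  (inj₂ refl) _           = inj₂ (∪-zeroˡ D)
    ∪-closure : ∀ C D → closure G C → closure G D → closure G (C ∪ D)
    ∪-closure C D C∈ D∈ = nonempty (proj₁ C∈) , (inj₁ G⊤ , closed)
      where
      nonempty : Nonempty C → Nonempty (C ∪ D)
      nonempty (x , x∈C) = x , x∈p∪q⁺ (inj₁ x∈C)
      closed : ∀ X Y → insert G (C ∪ D) X → insert G (C ∪ D) Y
             → insert G (C ∪ D) (X ∪ Y)
      closed X Y (inj₁ x) (inj₁ y) = inj₁ (G∪ X Y x y)
      closed X .(C ∪ D) (inj₁ x) (inj₂ refl) = closure-absorbs C D C∈ D∈ X x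
      closed .(C ∪ D) Y (inj₂ refl) (inj₁ y) =
        subst (insert G (C ∪ D)) (∪-comm Y (C ∪ D)) (closure-absorbs C D C∈ D∈ Y y)
      closed .(C ∪ D) .(C ∪ D) (inj₂ refl) (inj₂ refl) = inj₂ (∪-idem (C ∪ D))

  closure^-suc : ∀ m (G : Family n) → closure^ m (closure G) ≡ closure^ (suc m) G
  closure^-suc zero    G = refl
  closure^-suc (suc m) G = cong closure (closure^-suc m G)

  exchange : Subset n → Subset n → Subset n → Subset n
  exchange B A' A = (B ∩ ∁ A') ∪ A

  exchange-misses : ∀ {B A' A y} → y ∈ A' → y ∉ A → y ∉ exchange B A' A
  exchange-misses {B} {A'} {A} y∈A' y∉A h with x∈p∪q⁻ (B ∩ ∁ A') A h
  ... | inj₁ y∈B∖A' = x∈∁p⇒x∉p (proj₂ (x∈p∩q⁻ B (∁ A') y∈B∖A')) y∈A'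
  ... | inj₂ y∈A    = y∉A y∈A

  -- A sits strictly below the exchange set, since B ∖ A' is nonempty.
  below-exchange : ∀ {B A' A} → A ⊆ A' → A' ⊂ B → A ⊂ exchange B A' A
  below-exchange A⊆A' (_ , x , x∈B , x∉A') =
    (λ h → x∈p∪q⁺ (inj₂ h)) ,
    x , x∈p∪q⁺ (inj₁ (x∈p∩q⁺ (x∈B , x∉p⇒x∈∁p x∉A'))) , (λ h → x∉A' (A⊆A' h))

  exchange-∪ : ∀ {B A' A} → A ⊆ A' → A' ⊆ B → exchange B A' A ∪ A' ≡ B
  exchange-∪ {B} {A'} {A} A⊆A' A'⊆B = ⊆-antisym into onto
    where
    into : exchange B A' A ∪ A' ⊆ B
    into h with x∈p∪q⁻ (exchange B A' A) A' h
    ... | inj₂ y∈A' = A'⊆B y∈A'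
    ... | inj₁ y∈B' with x∈p∪q⁻ (B ∩ ∁ A') A y∈B'
    ...   | inj₁ y∈B∖A' = proj₁ (x∈p∩q⁻ B (∁ A') y∈B∖A')
    ...   | inj₂ y∈A    = A'⊆B (A⊆A' y∈A)
    onto : B ⊆ exchange B A' A ∪ A'
    onto {y} y∈B with y ∈? A'
    ... | yes y∈A' = x∈p∪q⁺ (inj₂ y∈A')
    ... | no  y∉A' = x∈p∪q⁺ (inj₁ (x∈p∪q⁺ (inj₁ (x∈p∩q⁺ (y∈B , x∉p⇒x∈∁p y∉A')))))

  -- The exchange lemma: the exchange set is not in the closure of G, as its
  -- union with A' ∈ G is neither in G (it is B) nor equal to itself.
  exchange-∉closure : ∀ {G B A' A} → A ⊂ A' → A' ⊆ B → G A' → ¬ G B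
                    → ¬ closure G (exchange B A' A)
  exchange-∉closure {G} {B} {A'} {A} (A⊆A' , y , y∈A' , y∉A) A'⊆B A'∈G B∉G (_ , (_ , closed))
    with closed (exchange B A' A) A' (inj₂ refl) (inj₁ A'∈G)
  ... | inj₁ ∪∈G = B∉G (subst G (exchange-∪ A⊆A' A'⊆B) ∪∈G)
  ... | inj₂ ∪≡B' = exchange-misses y∈A' y∉A (subst (y ∈_) ∪≡B' (x∈p∪q⁺ (inj₂ y∈A')))

  chain-misses : ∀ j {G} → Fin n → Proper G → (A : ℕ → Subset n) (B : Subset n)
               → (∀ i → i < j → A i ⊂ A (suc i)) → A j ⊂ B
               → (∀ i → 1 ≤ i → i ≤ j → G (A i)) → ¬ G B
               → ∀ m → m ≤ j → Misses (closure^ m G)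
  chain-misses j _ _ A B _ (_ , x , x∈B , _) _ B∉G zero _ = B , (x , x∈B) , B∉G
  chain-misses (suc j) {G} w proper A B chain Aⱼ₊₁⊂B inG B∉G (suc m) (s≤s m≤j) =
    subst Misses (closure^-suc m G)
      (chain-misses j w (closure-proper w proper) A B' shorter
        (below-exchange (proj₁ top) Aⱼ₊₁⊂B) inClosure B'∉closure m m≤j)
    where
    top : A j ⊂ A (suc j)
    top = chain j ≤-refl
    B' : Subset n
    B' = exchange B (A (suc j)) (A j)
    shorter : ∀ i → i < j → A i ⊂ A (suc i)
    shorter i i<j = chain i (≤-trans i<j (n≤1+n j))
    inClosure : ∀ i → 1 ≤ i → i ≤ j → closure G (A i)
    inClosure i 1≤i i≤j = member⇒closure proper (A i) (inG i 1≤i (≤-trans i≤j (n≤1+n j)))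
    B'∉closure : ¬ closure G B'
    B'∉closure = exchange-∉closure top (proj₁ Aⱼ₊₁⊂B) (inG (suc j) (s≤s z≤n) ≤-refl) B∉G

  withEmptyBase : (ℕ → Subset n) → ℕ → Subset n
  withEmptyBase A zero    = ⊥
  withEmptyBase A (suc i) = A (suc i)

  withEmptyBase-chain : ∀ r (A : ℕ → Subset n) → Nonempty (A 1)
                      → (∀ i → 1 ≤ i → i < r → A i ⊂ A (suc i))
                      → ∀ i → i < r → withEmptyBase A i ⊂ withEmptyBase A (suc i)
  withEmptyBase-chain r A (x , x∈A₁) chain zero    _   = (λ h → ⊥-elim (∉⊥ h)) , x , x∈A₁ , ∉⊥
  withEmptyBase-chain r A _        chain (suc i) i<r = chain (suc i) (s≤s z≤n) i<r

theorem1 : ∀ (n k r : ℕ) (F : Family n) → NoEmpty F → UnionClosed F → KDense k F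
    → (A : ℕ → Subset n) (B : Subset n)
    → 1 ≤ r
    → (∀ i → 1 ≤ i → i < r → A i ⊂ A (suc i))
    → A r ⊂ B
    → (∀ i → 1 ≤ i → i ≤ r → F (A i))
    → ¬ F B
    → r < k
theorem1 n k zero F _ _ _ A B () _ _ _ _
theorem1 n k (suc r) F noEmpty uc (power , _) A B _ chain Aᵣ⊂B inF B∉F =
  ≰⇒> λ k≤r → misses⇒notPower (closureMisses k k≤r) power
  where
  A₁-nonempty : Nonempty (A 1)
  A₁-nonempty = noEmpty (A 1) (inF 1 (s≤s z≤n) (s≤s z≤n))
  inF' : ∀ i → 1 ≤ i → i ≤ suc r → F (withEmptyBase A i)
  inF' (suc i) = inF (suc i)
  closureMisses : ∀ m → m ≤ suc r → Misses (closure^ m F)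
  closureMisses = chain-misses (suc r) (proj₁ A₁-nonempty) (uc , noEmpty)
    (withEmptyBase A) B (withEmptyBase-chain (suc r) A A₁-nonempty chain) Aᵣ⊂B inF' B∉F
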